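{- Let $w=[i_1,j_1][i_2,j_2]\cdots[i_p,j_p]$ be a fully commutative element of $W(A_n)$ in canonical form, with $p\ge1$. Then $$\mathscr L(w)=\{\sigma_{i_1}\}\cup\{\sigma_{i_k}:2\le k\le p,\ i_k<i_{k-1}-1\},\qquad \mathscr R(w)=\{\sigma_{j_p}\}\cup\{\sigma_{j_k}:1\le k\le p-1,\ j_k>j_{k+1}+1\}.$$
   Context: $W(A_n)$: Coxeter group with generators $S=\{\sigma_1,\dots,\sigma_n\}$ of type $A_n$, length $\ell$. $\mathscr L(w)=\{s\in S:\ell(sw)<\ell(w)\}$, $\mathscr R(w)=\{s\in S:\ell(ws)<\ell(w)\}$. FC = fully commutative (reduced expressions related by commutations only). $[i,j]=\sigma_i\cdots\sigma_j$; canonical form: $n\ge j_1>\cdots>j_p\ge1$, $n\ge i_1>\cdots>i_p\ge1$, $j_t\ge i_t$. -}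

module Defs where

open import Data.Nat using (ℕ; zero; suc; _+_; _∸_; _≤_; _<_; _≟_)
open import Data.List using (List; []; _∷_; _++_; length; map; upTo; concatMap)
open import Data.List.Relation.Unary.All using (All)
open import Data.Product using (_×_; ∃-syntax)
open import Data.Sum using (_⊎_)
open import Relation.Nullary using (yes; no)
open import Relation.Binary.PropositionalEquality using (_≡_)
open import Relation.Binary.Construct.Closure.ReflexiveTransitive using (Star)
open import Function using (_∘_; id)

-- W(A_n) realised as the group of permutations of {1,…,n+1} generated by
-- the adjacent transpositions σ_k = (k k+1), 1 ≤ k ≤ n.  Elements are
-- functions ℕ → ℕ (fixing everything outside {1,…,n+1}), compared pointwise.
Perm : Set
Perm = ℕ → ℕ

_≈_ : Perm → Perm → Set
f ≈ g = ∀ x → f x ≡ g x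

σ : ℕ → Perm
σ k x with x ≟ k
... | yes _ = suc k
... | no _ with x ≟ suc k
...   | yes _ = k
...   | no _ = x

Word : Set
Word = List ℕ

ValidWord : ℕ → Word → Set
ValidWord n ws = All (λ k → 1 ≤ k × k ≤ n) ws

eval : Word → Perm
eval [] = id
eval (k ∷ ws) = σ k ∘ eval ws

Represents : ℕ → Word → Perm → Set
Represents n ws f = ValidWord n ws × eval ws ≈ f

IsLength : ℕ → Perm → ℕ → Set
IsLength n f m =
  (∃[ ws ] (Represents n ws f × length ws ≡ m)) ×
  (∀ ws → Represents n ws f → m ≤ length ws)

LeftDescent : ℕ → ℕ → Perm → Set
LeftDescent n s f = ∃[ a ] ∃[ b ] (IsLength n (σ s ∘ f) a × IsLength n f b × a < b)

RightDescent : ℕ → ℕ → Perm → Set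
RightDescent n s f = ∃[ a ] ∃[ b ] (IsLength n (f ∘ σ s) a × IsLength n f b × a < b)

Reduced : ℕ → Perm → Word → Set
Reduced n f ws = Represents n ws f × IsLength n f (length ws)

data CommStep : Word → Word → Set where
  comm : ∀ xs ys s t → (suc (suc s) ≤ t ⊎ suc (suc t) ≤ s) →
         CommStep (xs ++ s ∷ t ∷ ys) (xs ++ t ∷ s ∷ ys)

FullyCommutative : ℕ → Perm → Set
FullyCommutative n f = ∀ a b → Reduced n f a → Reduced n f b → Star CommStep a b

-- [i,j] = σ_i σ_{i+1} ⋯ σ_j  (for i ≤ j)
interval : ℕ → ℕ → Word
interval i j = map (i +_) (upTo (suc (j ∸ i)))

-- [i₁,j₁][i₂,j₂]⋯[i_p,j_p], pairs indexed by t = 1,…,p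
canonWord : ℕ → (ℕ → ℕ) → (ℕ → ℕ) → Word
canonWord p i j = concatMap (λ t → interval (i t) (j t)) (map suc (upTo p))

canonElt : ℕ → (ℕ → ℕ) → (ℕ → ℕ) → Perm
canonElt p i j = eval (canonWord p i j)

{-# OPTIONS --safe #-}
-- The length of a permutation in W(A_n) = S_{n+1} is its number of inversions, so σ_s is a
-- right descent of w iff w(s+1) < w(s), and a left descent iff w⁻¹(s+1) < w⁻¹(s).  The factor
-- [i,j] acts as the cycle i ↦ i+1 ↦ ⋯ ↦ j+1 ↦ i; as j₁ > j₂ > ⋯ the product v of the factors
-- after the first moves only points ≤ j₂+1 and sends j₂+1 to i₂ < i₁.  Hence w = [i₁,j₁] v has
-- a descent at s < j₁ exactly when v has, none at s > j₁, and one at j₁ exactly when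
-- j₁ > j₂+1; induction on p gives 𝓡(w).  Peeling off the factor [i_p,j_p]⁻¹ of
-- w⁻¹ = [i_p,j_p]⁻¹ ⋯ [i₁,j₁]⁻¹ in the same way gives 𝓛(w).
module Submission where

open import Defs
open import Data.Nat using (ℕ; zero; suc; pred; _≤_; _<_; _+_; _∸_; z≤n; s≤s; z<s)
open import Data.Nat.Properties
open import Data.Product using (_×_; ∃-syntax; _,_)
open import Data.Sum using (_⊎_; inj₁; inj₂)
open import Data.List using ([]; _∷_; _++_; length; applyUpTo; concatMap; reverse)
open import Data.List.Properties using (++-assoc; ++-identityʳ; map-applyUpTo; unfold-reverse; reverse-++; length-reverse)
open import Data.List.Relation.Unary.All using ([]; _∷_)
open import Data.List.Relation.Unary.All.Properties using (++⁺; ∷ʳ⁺)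
open import Data.Empty using (⊥-elim)
open import Relation.Nullary using (¬_; yes; no)
open import Relation.Binary using (tri<; tri≈; tri>)
open import Function using (_∘_; id)
open import Function.Bundles using (_⇔_; mk⇔; Equivalence)
open import Function.Properties.Equivalence using () renaming (trans to ⇔-trans)
open import Relation.Binary.PropositionalEquality using (_≡_; refl; sym; trans; cong; cong₂; subst; subst₂; _≢_; module ≡-Reasoning)

σ-below : ∀ k {x} → x < k → σ k x ≡ x
σ-below k {x} x<k with x ≟ k
... | yes refl = ⊥-elim (<-irrefl refl x<k)
... | no _ with x ≟ suc k
...   | yes refl = ⊥-elim (<-asym x<k (n<1+n k))
...   | no _ = refl

σ-at : ∀ k → σ k k ≡ suc k
σ-at k with k ≟ k
... | yes _ = refl
... | no k≢k = ⊥-elim (k≢k refl)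

σ-at-suc : ∀ k → σ k (suc k) ≡ k
σ-at-suc k with suc k ≟ k
... | yes e = ⊥-elim (1+n≢n e)
... | no _ with suc k ≟ suc k
...   | yes _ = refl
...   | no k≢k = ⊥-elim (k≢k refl)

σ-above : ∀ k {x} → suc k < x → σ k x ≡ x
σ-above k {x} k+1<x with x ≟ k
... | yes refl = ⊥-elim (<-asym k+1<x (n<1+n k))
... | no _ with x ≟ suc k
...   | yes refl = ⊥-elim (<-irrefl refl k+1<x)
...   | no _ = refl

data σ-View (k : ℕ) : ℕ → Set where
  below  : ∀ {x} → x < k → σ-View k x
  at     : σ-View k k
  at-suc : σ-View k (suc k)
  above  : ∀ {x} → suc k < x → σ-View k x

σ-view : ∀ k x → σ-View k x
σ-view k x with <-cmp x k
... | tri< x<k _ _ = below x<k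
... | tri≈ _ refl _ = at
... | tri> _ _ k<x with <-cmp x (suc k)
...   | tri< x<k+1 _ _ = ⊥-elim (<⇒≱ x<k+1 k<x)
...   | tri≈ _ refl _ = at-suc
...   | tri> _ _ k+1<x = above k+1<x

σ-involutive : ∀ k x → σ k (σ k x) ≡ x
σ-involutive k x with σ-view k x
... | below x<k rewrite σ-below k x<k = σ-below k x<k
... | at rewrite σ-at k = σ-at-suc k
... | at-suc rewrite σ-at-suc k = σ-at k
... | above k+1<x rewrite σ-above k k+1<x = σ-above k k+1<x

σ-bounded : ∀ {k m} x → suc k < m → x < m → σ k x < m
σ-bounded {k} x k+1<m x<m with σ-view k x
... | below x<k rewrite σ-below k x<k = x<m
... | at rewrite σ-at k = k+1<m
... | at-suc rewrite σ-at-suc k = <-trans (n<1+n k) k+1<m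
... | above k+1<x rewrite σ-above k k+1<x = x<m

σ-monotone : ∀ k {u v} → u < v → ¬ (u ≡ k × v ≡ suc k) → σ k u < σ k v
σ-monotone k {u} {v} u<v not-swapped with σ-view k u | σ-view k v
... | below u<k | below v<k rewrite σ-below k u<k | σ-below k v<k = u<v
... | below u<k | at rewrite σ-below k u<k | σ-at k = m<n⇒m<1+n u<k
... | below u<k | at-suc rewrite σ-below k u<k | σ-at-suc k = u<k
... | below u<k | above k+1<v rewrite σ-below k u<k | σ-above k k+1<v = u<v
... | at | below v<k = ⊥-elim (<-asym u<v v<k)
... | at | at = ⊥-elim (<-irrefl refl u<v)
... | at | at-suc = ⊥-elim (not-swapped (refl , refl))
... | at | above k+1<v rewrite σ-at k | σ-above k k+1<v = k+1<v
... | at-suc | below v<k = ⊥-elim (<-asym u<v (<-trans v<k (n<1+n k)))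
... | at-suc | at = ⊥-elim (<-asym u<v (n<1+n k))
... | at-suc | at-suc = ⊥-elim (<-irrefl refl u<v)
... | at-suc | above k+1<v rewrite σ-at-suc k | σ-above k k+1<v = <-trans (n<1+n k) k+1<v
... | above k+1<u | below v<k = ⊥-elim (<-asym u<v (<-trans v<k (<-trans (n<1+n k) k+1<u)))
... | above k+1<u | at = ⊥-elim (<-asym u<v (<-trans (n<1+n k) k+1<u))
... | above k+1<u | at-suc = ⊥-elim (<-asym u<v k+1<u)
... | above k+1<u | above k+1<v rewrite σ-above k k+1<u | σ-above k k+1<v = u<v

σ-preserves-< : ∀ k {u v} → ¬ (u ≡ k × v ≡ suc k) → ¬ (u ≡ suc k × v ≡ k) → (u < v ⇔ σ k u < σ k v)
σ-preserves-< k {u} {v} not-kk+1 not-k+1k = mk⇔ (λ u<v → σ-monotone k u<v not-kk+1) reflect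
  where
  reflect : σ k u < σ k v → u < v
  reflect σu<σv = subst₂ _<_ (σ-involutive k u) (σ-involutive k v)
    (σ-monotone k σu<σv λ { (σu≡k , σv≡k+1) → not-k+1k
      ( trans (sym (σ-involutive k u)) (trans (cong (σ k) σu≡k) (σ-at k))
      , trans (sym (σ-involutive k v)) (trans (cong (σ k) σv≡k+1) (σ-at-suc k)) ) })

χ< : ℕ → ℕ → ℕ
χ< a b with a <? b
... | yes _ = 1
... | no _ = 0

χ<-cong : ∀ {a b c d} → (a < b ⇔ c < d) → χ< a b ≡ χ< c d
χ<-cong {a} {b} {c} {d} a<b⇔c<d with a <? b | c <? d
... | yes _ | yes _ = refl
... | yes a<b | no c≮d = ⊥-elim (c≮d (Equivalence.to a<b⇔c<d a<b))
... | no a≮b | yes c<d = ⊥-elim (a≮b (Equivalence.from a<b⇔c<d c<d))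
... | no _ | no _ = refl

χ<-≡1 : ∀ {a b} → a < b → χ< a b ≡ 1
χ<-≡1 {a} {b} a<b with a <? b
... | yes _ = refl
... | no a≮b = ⊥-elim (a≮b a<b)

χ<-≡0 : ∀ {a b} → ¬ a < b → χ< a b ≡ 0
χ<-≡0 {a} {b} a≮b with a <? b
... | yes a<b = ⊥-elim (a≮b a<b)
... | no _ = refl

χ<-pos⇒< : ∀ {a b} → 0 < χ< a b → a < b
χ<-pos⇒< {a} {b} χ>0 with a <? b
... | yes a<b = a<b
... | no _ = ⊥-elim (<-irrefl refl χ>0)

χ<≡0⇒≮ : ∀ {a b} → χ< a b ≡ 0 → ¬ a < b
χ<≡0⇒≮ {a} {b} χ≡0 a<b = 1+n≢0 (trans (sym (χ<-≡1 a<b)) χ≡0)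

χ<-σ : ∀ k {u v} → ¬ (u ≡ k × v ≡ suc k) → ¬ (u ≡ suc k × v ≡ k) → χ< (σ k u) (σ k v) ≡ χ< u v
χ<-σ k not-kk+1 not-k+1k = sym (χ<-cong (σ-preserves-< k not-kk+1 not-k+1k))

∑< : ℕ → (ℕ → ℕ) → ℕ
∑< zero h = 0
∑< (suc m) h = ∑< m h + h m

∑<-cong : ∀ m {h h′ : ℕ → ℕ} → (∀ x → x < m → h x ≡ h′ x) → ∑< m h ≡ ∑< m h′
∑<-cong zero _ = refl
∑<-cong (suc m) h≡h′ = cong₂ _+_ (∑<-cong m (λ x x<m → h≡h′ x (m<n⇒m<1+n x<m))) (h≡h′ m (n<1+n m))

∑<-suc-at : ∀ m {h h′ : ℕ → ℕ} a → a < m → (∀ x → x < m → x ≢ a → h′ x ≡ h x) →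
            h′ a ≡ suc (h a) → ∑< m h′ ≡ suc (∑< m h)
∑<-suc-at (suc m) {h} {h′} a a<m+1 h′≡h h′a with <-cmp a m
... | tri< a<m _ _ = cong₂ _+_ (∑<-suc-at m a a<m (λ x x<m → h′≡h x (m<n⇒m<1+n x<m)) h′a)
                              (h′≡h m (n<1+n m) λ m≡a → <-irrefl (sym m≡a) a<m)
... | tri≈ _ refl _ =
  trans (cong₂ _+_ (∑<-cong m (λ x x<m → h′≡h x (m<n⇒m<1+n x<m) λ { refl → <-irrefl refl x<m })) h′a)
                            (+-suc (∑< m h) (h m))
... | tri> _ _ m<a = ⊥-elim (<⇒≱ m<a (≤-pred a<m+1))

∑<-pos⇒ : ∀ m h → 0 < ∑< m h → ∃[ x ] (x < m × 0 < h x)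
∑<-pos⇒ (suc m) h ∑>0 with h m in hm≡
... | suc _ = m , n<1+n m , subst (0 <_) (sym hm≡) z<s
... | zero with ∑<-pos⇒ m h (subst (0 <_) (+-identityʳ _) ∑>0)
...   | x , x<m , hx>0 = x , m<n⇒m<1+n x<m , hx>0

∑<≡0⇒ : ∀ m h → ∑< m h ≡ 0 → ∀ x → x < m → h x ≡ 0
∑<≡0⇒ (suc m) h ∑≡0 x x<m+1 with m≤n⇒m<n∨m≡n (≤-pred x<m+1)
... | inj₁ x<m = ∑<≡0⇒ m h (m+n≡0⇒m≡0 (∑< m h) ∑≡0) x x<m
... | inj₂ refl = m+n≡0⇒n≡0 (∑< m h) ∑≡0

∑<-zero : ∀ m h → (∀ x → x < m → h x ≡ 0) → ∑< m h ≡ 0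
∑<-zero zero h _ = refl
∑<-zero (suc m) h h≡0 = cong₂ _+_ (∑<-zero m h (λ x x<m → h≡0 x (m<n⇒m<1+n x<m))) (h≡0 m (n<1+n m))

record InSym (n : ℕ) (f : Perm) : Set where
  field
    inverse         : Perm
    inverse-f       : ∀ x → inverse (f x) ≡ x
    f-inverse       : ∀ x → f (inverse x) ≡ x
    bounded         : ∀ x → x < 2 + n → f x < 2 + n
    inverse-bounded : ∀ x → x < 2 + n → inverse x < 2 + n
    fixes-0         : f 0 ≡ 0
    fixes-large     : ∀ x → 2 + n ≤ x → f x ≡ x

  injective : ∀ x y → f x ≡ f y → x ≡ y
  injective x y fx≡fy = trans (sym (inverse-f x)) (trans (cong inverse fx≡fy) (inverse-f y))

  inverse-injective : ∀ x y → inverse x ≡ inverse y → x ≡ y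
  inverse-injective x y gx≡gy = trans (sym (f-inverse x)) (trans (cong f gx≡gy) (f-inverse y))

  inverse-unique : ∀ x y → f x ≡ y → x ≡ inverse y
  inverse-unique x y fx≡y = trans (sym (inverse-f x)) (cong inverse fx≡y)

open InSym

InSym-id : ∀ {n} → InSym n id
InSym-id = record
  { inverse = id ; inverse-f = λ _ → refl ; f-inverse = λ _ → refl
  ; bounded = λ _ x<m → x<m ; inverse-bounded = λ _ x<m → x<m
  ; fixes-0 = refl ; fixes-large = λ _ _ → refl }

module _ {n k : ℕ} (1≤k : 1 ≤ k) (k≤n : k ≤ n) where

  private
    k+1<2+n : suc k < 2 + n
    k+1<2+n = s≤s (s≤s k≤n)

    σ-fixes-large : ∀ x → 2 + n ≤ x → σ k x ≡ x
    σ-fixes-large x 2+n≤x = σ-above k (<-≤-trans k+1<2+n 2+n≤x)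

  InSym-σˡ : ∀ {f} → InSym n f → InSym n (σ k ∘ f)
  InSym-σˡ {f} F = record
    { inverse = inverse F ∘ σ k
    ; inverse-f = λ x → trans (cong (inverse F) (σ-involutive k (f x))) (inverse-f F x)
    ; f-inverse = λ x → trans (cong (σ k) (f-inverse F (σ k x))) (σ-involutive k x)
    ; bounded = λ x x<m → σ-bounded (f x) k+1<2+n (bounded F x x<m)
    ; inverse-bounded = λ x x<m → inverse-bounded F (σ k x) (σ-bounded x k+1<2+n x<m)
    ; fixes-0 = trans (cong (σ k) (fixes-0 F)) (σ-below k 1≤k)
    ; fixes-large = λ x m≤x → trans (cong (σ k) (fixes-large F x m≤x)) (σ-fixes-large x m≤x) }

  InSym-σʳ : ∀ {f} → InSym n f → InSym n (f ∘ σ k)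
  InSym-σʳ {f} F = record
    { inverse = σ k ∘ inverse F
    ; inverse-f = λ x → trans (cong (σ k) (inverse-f F (σ k x))) (σ-involutive k x)
    ; f-inverse = λ x → trans (cong f (σ-involutive k (inverse F x))) (f-inverse F x)
    ; bounded = λ x x<m → bounded F (σ k x) (σ-bounded x k+1<2+n x<m)
    ; inverse-bounded = λ x x<m → σ-bounded (inverse F x) k+1<2+n (inverse-bounded F x x<m)
    ; fixes-0 = trans (cong f (σ-below k 1≤k)) (fixes-0 F)
    ; fixes-large = λ x m≤x → trans (cong f (σ-fixes-large x m≤x)) (fixes-large F x m≤x) }

InSym-inverse : ∀ {n f} (F : InSym n f) → InSym n (inverse F)
InSym-inverse {f = f} F = record
  { inverse = f ; inverse-f = f-inverse F ; f-inverse = inverse-f F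
  ; bounded = inverse-bounded F ; inverse-bounded = bounded F
  ; fixes-0 = sym (inverse-unique F 0 0 (fixes-0 F))
  ; fixes-large = λ x m≤x → sym (inverse-unique F x x (fixes-large F x m≤x)) }

InSym-eval : ∀ {n} ws → ValidWord n ws → InSym n (eval ws)
InSym-eval [] [] = InSym-id
InSym-eval (k ∷ ws) ((1≤k , k≤n) ∷ valid) = InSym-σˡ 1≤k k≤n (InSym-eval ws valid)

inversionsBelow : Perm → ℕ → ℕ
inversionsBelow f y = ∑< y (λ x → χ< (f y) (f x))

-- The range 0,…,n+1 includes the fixed point 0, which takes part in no inversion.
inversions : ℕ → Perm → ℕ
inversions n f = ∑< (2 + n) (inversionsBelow f)

inversions-cong : ∀ n {f f′} → f ≈ f′ → inversions n f ≡ inversions n f′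
inversions-cong n f≈f′ = ∑<-cong (2 + n) λ y _ → ∑<-cong y λ x _ → cong₂ χ< (f≈f′ y) (f≈f′ x)

inversions-id : ∀ n → inversions n id ≡ 0
inversions-id n = ∑<-zero (2 + n) (inversionsBelow id) λ y _ → ∑<-zero y (χ< y) λ x x<y → χ<-≡0 (<-asym x<y)

-- σ_k exchanges the values k and k+1, so the only pair whose order changes is (f⁻¹ k, f⁻¹ (k+1)).
inversions-σˡ-suc : ∀ {n f k} (F : InSym n f) → k ≤ n → inverse F k < inverse F (suc k) →
                    inversions n (σ k ∘ f) ≡ suc (inversions n f)
inversions-σˡ-suc {n} {f} {k} F k≤n a<b =
  ∑<-suc-at (2 + n) b (inverse-bounded F (suc k) (s≤s (s≤s k≤n))) unchanged-row changed-row
  where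
  open ≡-Reasoning
  a = inverse F k
  b = inverse F (suc k)

  unchanged-row : ∀ y → y < 2 + n → y ≢ b → inversionsBelow (σ k ∘ f) y ≡ inversionsBelow f y
  unchanged-row y _ y≢b = ∑<-cong y λ x x<y → χ<-σ k
    (λ (fy≡k , fx≡k+1) → <-asym a<b (subst₂ _<_ (inverse-unique F x _ fx≡k+1) (inverse-unique F y _ fy≡k) x<y))
    (λ (fy≡k+1 , _) → y≢b (inverse-unique F y _ fy≡k+1))

  new-inversion : χ< (σ k (f b)) (σ k (f a)) ≡ suc (χ< (f b) (f a))
  new-inversion = begin
    χ< (σ k (f b)) (σ k (f a)) ≡⟨ cong₂ (λ u v → χ< (σ k u) (σ k v)) (f-inverse F (suc k)) (f-inverse F k) ⟩
    χ< (σ k (suc k)) (σ k k)   ≡⟨ cong₂ χ< (σ-at-suc k) (σ-at k) ⟩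
    χ< k (suc k)               ≡⟨ χ<-≡1 (n<1+n k) ⟩
    suc 0                      ≡⟨ cong suc (sym (χ<-≡0 (<-asym (n<1+n k)))) ⟩
    suc (χ< (suc k) k)         ≡⟨ cong suc (sym (cong₂ χ< (f-inverse F (suc k)) (f-inverse F k))) ⟩
    suc (χ< (f b) (f a))       ∎

  changed-row : inversionsBelow (σ k ∘ f) b ≡ suc (inversionsBelow f b)
  changed-row = ∑<-suc-at b a a<b
    (λ x _ x≢a → χ<-σ k
      (λ (fb≡k , _) → 1+n≢n (trans (sym (f-inverse F (suc k))) fb≡k))
      (λ (_ , fx≡k) → x≢a (inverse-unique F x _ fx≡k)))
    new-inversion

inversions-σˡ-pred : ∀ {n f k} (F : InSym n f) → 1 ≤ k → k ≤ n → inverse F (suc k) < inverse F k →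
                     inversions n f ≡ suc (inversions n (σ k ∘ f))
inversions-σˡ-pred {n} {f} {k} F 1≤k k≤n b<a = trans
  (inversions-cong n λ x → sym (σ-involutive k (f x)))
  (inversions-σˡ-suc (InSym-σˡ 1≤k k≤n F) k≤n
    (subst₂ _<_ (sym (cong (inverse F) (σ-at k))) (sym (cong (inverse F) (σ-at-suc k))) b<a))

inversions-σˡ-≤ : ∀ {n f k} (F : InSym n f) → 1 ≤ k → k ≤ n → inversions n (σ k ∘ f) ≤ suc (inversions n f)
inversions-σˡ-≤ {k = k} F 1≤k k≤n with <-cmp (inverse F k) (inverse F (suc k))
... | tri< a<b _ _ = ≤-reflexive (inversions-σˡ-suc F k≤n a<b)
... | tri≈ _ a≡b _ = ⊥-elim (1+n≢n (sym (inverse-injective F k (suc k) a≡b)))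
... | tri> _ _ b<a = ≤-trans (n≤1+n _) (≤-trans (≤-reflexive (sym (inversions-σˡ-pred F 1≤k k≤n b<a))) (n≤1+n _))

inversions≤length : ∀ {n} ws → ValidWord n ws → inversions n (eval ws) ≤ length ws
inversions≤length {n} [] [] = ≤-reflexive (inversions-id n)
inversions≤length (k ∷ ws) ((1≤k , k≤n) ∷ valid) =
  ≤-trans (inversions-σˡ-≤ (InSym-eval ws valid) 1≤k k≤n) (s≤s (inversions≤length ws valid))

strictMono⇒≤ : ∀ {m} (h : ℕ → ℕ) → (∀ {x y} → x < y → y < m → h x < h y) → ∀ x → x < m → x ≤ h x
strictMono⇒≤ h mono zero _ = z≤n
strictMono⇒≤ h mono (suc x) x+1<m =
  ≤-trans (s≤s (strictMono⇒≤ h mono x (<-trans (n<1+n x) x+1<m))) (mono (n<1+n x) x+1<m)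

inversions≡0⇒≈id : ∀ {n f} (F : InSym n f) → inversions n f ≡ 0 → f ≈ id
inversions≡0⇒≈id {n} {f} F no-inversions x with x <? 2 + n
... | no x≮m = fixes-large F x (≮⇒≥ x≮m)
... | yes x<m = ≤-antisym
  (subst (f x ≤_) (inverse-f F x) (strictMono⇒≤ (inverse F) inverse-mono (f x) (bounded F x x<m)))
  (strictMono⇒≤ f f-mono x x<m)
  where
  f-mono : ∀ {x y} → x < y → y < 2 + n → f x < f y
  f-mono {x} {y} x<y y<m = ≤∧≢⇒<
    (≮⇒≥ (χ<≡0⇒≮ (∑<≡0⇒ y _ (∑<≡0⇒ (2 + n) (inversionsBelow f) no-inversions y y<m) x x<y)))
    (λ fx≡fy → <-irrefl (injective F x y fx≡fy) x<y)
  inverse-mono : ∀ {x y} → x < y → y < 2 + n → inverse F x < inverse F y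
  inverse-mono {x} {y} x<y y<m with <-cmp (inverse F x) (inverse F y)
  ... | tri< gx<gy _ _ = gx<gy
  ... | tri≈ _ gx≡gy _ = ⊥-elim (<-irrefl (inverse-injective F x y gx≡gy) x<y)
  ... | tri> _ _ gy<gx = ⊥-elim (<-asym x<y (subst₂ _<_ (f-inverse F y) (f-inverse F x)
          (f-mono gy<gx (inverse-bounded F x (<-trans x<y y<m)))))

descent-between : ∀ (h : ℕ → ℕ) {a b} → a < b → h b < h a → ∃[ s ] (a ≤ s × s < b × h (suc s) < h s)
descent-between h {a} {suc b} a<b+1 hb+1<ha with h (suc b) <? h b
... | yes hb+1<hb = b , ≤-pred a<b+1 , n<1+n b , hb+1<hb
... | no hb+1≮hb with m≤n⇒m<n∨m≡n (≤-pred a<b+1)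
...   | inj₂ refl = ⊥-elim (hb+1≮hb hb+1<ha)
...   | inj₁ a<b with descent-between h a<b (≤-<-trans (≮⇒≥ hb+1≮hb) hb+1<ha)
...     | s , a≤s , s<b , descent = s , a≤s , m<n⇒m<1+n s<b , descent

inversion⇒inverseDescent : ∀ {n f x y} (F : InSym n f) → x < y → y < 2 + n → f y < f x →
                           ∃[ s ] (1 ≤ s × s ≤ n × inverse F (suc s) < inverse F s)
inversion⇒inverseDescent {n} {f} {x} {y} F x<y y<m fy<fx
  with descent-between (inverse F) fy<fx (subst₂ _<_ (sym (inverse-f F x)) (sym (inverse-f F y)) x<y)
... | s , fy≤s , s<fx , descent =
  s , ≤-trans 1≤fy fy≤s , ≤-pred (≤-pred (<-≤-trans (s≤s s<fx) (bounded F x (<-trans x<y y<m)))) , descent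
  where
  1≤fy : 1 ≤ f y
  1≤fy = n≢0⇒n>0 λ fy≡0 → <-irrefl (sym (injective F y 0 (trans fy≡0 (sym (fixes-0 F))))) (≤-<-trans z≤n x<y)

word-of-length-inversions : ∀ {n f} m (F : InSym n f) → inversions n f ≡ m →
                            ∃[ ws ] (Represents n ws f × length ws ≡ m)
word-of-length-inversions zero F no-inversions = [] , ([] , λ x → sym (inversions≡0⇒≈id F no-inversions x)) , refl
word-of-length-inversions {n} {f} (suc m) F inversions≡m+1
  with ∑<-pos⇒ (2 + n) (inversionsBelow f) (subst (0 <_) (sym inversions≡m+1) z<s)
... | y , y<m , row>0 with ∑<-pos⇒ y (λ x → χ< (f y) (f x)) row>0
...   | x , x<y , χ>0 with inversion⇒inverseDescent F x<y y<m (χ<-pos⇒< χ>0)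
...     | s , 1≤s , s≤n , descent with word-of-length-inversions m (InSym-σˡ 1≤s s≤n F)
            (suc-injective (trans (sym (inversions-σˡ-pred F 1≤s s≤n descent)) inversions≡m+1))
...       | ws , (valid , ws≈σf) , length≡m =
  s ∷ ws , ((1≤s , s≤n) ∷ valid , λ z → trans (cong (σ s) (ws≈σf z)) (σ-involutive s (f z))) , cong suc length≡m

isLength-inversions : ∀ {n f} → InSym n f → IsLength n f (inversions n f)
isLength-inversions {n} F =
  word-of-length-inversions _ F refl ,
  λ ws (valid , ws≈f) → ≤-trans (≤-reflexive (inversions-cong n λ x → sym (ws≈f x))) (inversions≤length ws valid)

isLength⇒≡inversions : ∀ {n f m} → InSym n f → IsLength n f m → m ≡ inversions n f
isLength⇒≡inversions {n} F ((ws , (valid , ws≈f) , length≡m) , minimal)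
  with word-of-length-inversions _ F refl
... | ws′ , represents′ , length′≡ = ≤-antisym
  (subst (_ ≤_) length′≡ (minimal ws′ represents′))
  (subst₂ _≤_ (inversions-cong n ws≈f) length≡m (inversions≤length ws valid))

eval-++ : ∀ xs ys x → eval (xs ++ ys) x ≡ eval xs (eval ys x)
eval-++ [] ys x = refl
eval-++ (k ∷ xs) ys x = cong (σ k) (eval-++ xs ys x)

eval-reverse : ∀ k ws x → eval (reverse (k ∷ ws)) x ≡ eval (reverse ws) (σ k x)
eval-reverse k ws x = trans (cong (λ vs → eval vs x) (unfold-reverse k ws)) (eval-++ (reverse ws) (k ∷ []) x)

eval-reverse-inverseˡ : ∀ ws x → eval (reverse ws) (eval ws x) ≡ x
eval-reverse-inverseˡ [] x = refl
eval-reverse-inverseˡ (k ∷ ws) x = begin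
  eval (reverse (k ∷ ws)) (σ k (eval ws x)) ≡⟨ eval-reverse k ws _ ⟩
  eval (reverse ws) (σ k (σ k (eval ws x))) ≡⟨ cong (eval (reverse ws)) (σ-involutive k _) ⟩
  eval (reverse ws) (eval ws x)             ≡⟨ eval-reverse-inverseˡ ws x ⟩
  x                                         ∎
  where open ≡-Reasoning

eval-reverse-inverseʳ : ∀ ws x → eval ws (eval (reverse ws) x) ≡ x
eval-reverse-inverseʳ [] x = refl
eval-reverse-inverseʳ (k ∷ ws) x = begin
  σ k (eval ws (eval (reverse (k ∷ ws)) x)) ≡⟨ cong (σ k ∘ eval ws) (eval-reverse k ws x) ⟩
  σ k (eval ws (eval (reverse ws) (σ k x))) ≡⟨ cong (σ k) (eval-reverse-inverseʳ ws (σ k x)) ⟩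
  σ k (σ k x)                               ≡⟨ σ-involutive k x ⟩
  x                                         ∎
  where open ≡-Reasoning

ValidWord-reverse : ∀ {n} ws → ValidWord n ws → ValidWord n (reverse ws)
ValidWord-reverse [] [] = []
ValidWord-reverse {n} (k ∷ ws) (valid-k ∷ valid) =
  subst (ValidWord n) (sym (unfold-reverse k ws)) (∷ʳ⁺ (ValidWord-reverse ws valid) valid-k)

inversions-≤-inverse : ∀ {n f} (F : InSym n f) → inversions n f ≤ inversions n (inverse F)
inversions-≤-inverse {n} {f} F with word-of-length-inversions _ (InSym-inverse F) refl
... | ws , (valid , ws≈g) , length≡ = begin
  inversions n f                    ≡⟨ inversions-cong n reverse-ws≈f ⟨
  inversions n (eval (reverse ws))  ≤⟨ inversions≤length (reverse ws) (ValidWord-reverse ws valid) ⟩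
  length (reverse ws)               ≡⟨ length-reverse ws ⟩
  length ws                         ≡⟨ length≡ ⟩
  inversions n (inverse F)          ∎
  where
  open ≤-Reasoning
  reverse-ws≈f : eval (reverse ws) ≈ f
  reverse-ws≈f x = trans (cong (eval (reverse ws)) (sym (trans (ws≈g (f x)) (inverse-f F x))))
                         (eval-reverse-inverseˡ ws (f x))

inversions-inverse : ∀ {n f} (F : InSym n f) → inversions n f ≡ inversions n (inverse F)
inversions-inverse F = ≤-antisym (inversions-≤-inverse F) (inversions-≤-inverse (InSym-inverse F))

shorter⇔fewerInversions : ∀ {n f f′} → InSym n f → InSym n f′ →
  (∃[ a ] ∃[ b ] (IsLength n f′ a × IsLength n f b × a < b)) ⇔ inversions n f′ < inversions n f
shorter⇔fewerInversions F F′ = mk⇔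
  (λ (_ , _ , length-f′ , length-f , a<b) →
     subst₂ _<_ (isLength⇒≡inversions F′ length-f′) (isLength⇒≡inversions F length-f) a<b)
  (λ fewer → _ , _ , isLength-inversions F′ , isLength-inversions F , fewer)

fewerInversions-σˡ⇔ : ∀ {n f k} (F : InSym n f) → 1 ≤ k → k ≤ n →
  inversions n (σ k ∘ f) < inversions n f ⇔ inverse F (suc k) < inverse F k
fewerInversions-σˡ⇔ {n} {f} {k} F 1≤k k≤n = mk⇔ to (λ b<a → ≤-reflexive (sym (inversions-σˡ-pred F 1≤k k≤n b<a)))
  where
  to : inversions n (σ k ∘ f) < inversions n f → inverse F (suc k) < inverse F k
  to fewer with <-cmp (inverse F k) (inverse F (suc k))
  ... | tri< a<b _ _ = ⊥-elim (<-asym fewer (subst (inversions n f <_) (sym (inversions-σˡ-suc F k≤n a<b)) (n<1+n (inversions n f))))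
  ... | tri≈ _ a≡b _ = ⊥-elim (1+n≢n (sym (inverse-injective F k (suc k) a≡b)))
  ... | tri> _ _ b<a = b<a

leftDescent⇔ : ∀ {n f s} (F : InSym n f) → 1 ≤ s → s ≤ n → LeftDescent n s f ⇔ inverse F (suc s) < inverse F s
leftDescent⇔ F 1≤s s≤n =
  ⇔-trans (shorter⇔fewerInversions F (InSym-σˡ 1≤s s≤n F)) (fewerInversions-σˡ⇔ F 1≤s s≤n)

rightDescent⇔ : ∀ {n f s} (F : InSym n f) → 1 ≤ s → s ≤ n → RightDescent n s f ⇔ f (suc s) < f s
rightDescent⇔ {n} {f} {s} F 1≤s s≤n =
  ⇔-trans (shorter⇔fewerInversions F (InSym-σʳ 1≤s s≤n F))
  (⇔-trans (mk⇔ (subst₂ _<_ same-σ same) (subst₂ _<_ (sym same-σ) (sym same)))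
           (fewerInversions-σˡ⇔ (InSym-inverse F) 1≤s s≤n))
  where
  same-σ : inversions n (f ∘ σ s) ≡ inversions n (σ s ∘ inverse F)
  same-σ = inversions-inverse (InSym-σʳ 1≤s s≤n F)
  same : inversions n f ≡ inversions n (inverse F)
  same = inversions-inverse F

ascending : ℕ → ℕ → Word
ascending i zero = []
ascending i (suc m) = i ∷ ascending (suc i) m

applyUpTo≡ascending : ∀ m i (h : ℕ → ℕ) → (∀ t → h t ≡ i + t) → applyUpTo h m ≡ ascending i m
applyUpTo≡ascending zero i h h≡ = refl
applyUpTo≡ascending (suc m) i h h≡ = cong₂ _∷_ (trans (h≡ 0) (+-identityʳ i))
  (applyUpTo≡ascending m (suc i) (h ∘ suc) λ t → trans (h≡ (suc t)) (+-suc i t))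

interval≡ascending : ∀ i j → interval i j ≡ ascending i (suc (j ∸ i))
interval≡ascending i j = trans (map-applyUpTo id (i +_) (suc (j ∸ i))) (applyUpTo≡ascending _ i (i +_) λ _ → refl)

interval-end : ∀ {i j} → i ≤ j → i + suc (j ∸ i) ≡ suc j
interval-end {i} i≤j = trans (+-suc i _) (cong suc (m+[n∸m]≡n i≤j))

ascending-below : ∀ m i {x} → x < i → eval (ascending i m) x ≡ x
ascending-below zero i x<i = refl
ascending-below (suc m) i x<i = trans (cong (σ i) (ascending-below m (suc i) (m<n⇒m<1+n x<i))) (σ-below i x<i)

ascending-inside : ∀ m i {x} → i ≤ x → x < i + m → eval (ascending i m) x ≡ suc x
ascending-inside zero i {x} i≤x x<i+0 = ⊥-elim (<⇒≱ (subst (x <_) (+-identityʳ i) x<i+0) i≤x)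
ascending-inside (suc m) i {x} i≤x x<i+m+1 with m≤n⇒m<n∨m≡n i≤x
... | inj₂ refl = trans (cong (σ i) (ascending-below m (suc i) (n<1+n i))) (σ-at i)
... | inj₁ i<x = trans (cong (σ i) (ascending-inside m (suc i) i<x (subst (x <_) (+-suc i m) x<i+m+1)))
                       (σ-above i (s≤s i<x))

ascending-end : ∀ m i → eval (ascending i m) (i + m) ≡ i
ascending-end zero i = +-identityʳ i
ascending-end (suc m) i = trans (cong (σ i ∘ eval (ascending (suc i) m)) (+-suc i m))
                                (trans (cong (σ i) (ascending-end m (suc i))) (σ-at-suc i))

ascending-above : ∀ m i {x} → i + m < x → eval (ascending i m) x ≡ x
ascending-above zero i i+0<x = refl
ascending-above (suc m) i {x} i+m+1<x =
  trans (cong (σ i) (ascending-above m (suc i) i+1+m<x)) (σ-above i (≤-<-trans (s≤s (m≤m+n i m)) i+1+m<x))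
  where
  i+1+m<x : suc i + m < x
  i+1+m<x = subst (_< x) (+-suc i m) i+m+1<x

cyc : ℕ → ℕ → Perm
cyc i j = eval (interval i j)

cyc⁻¹ : ℕ → ℕ → Perm
cyc⁻¹ i j = eval (reverse (interval i j))

module _ {i j : ℕ} where

  private
    len : ℕ
    len = suc (j ∸ i)

    eval-interval : ∀ {x y} → eval (ascending i len) x ≡ y → cyc i j x ≡ y
    eval-interval {x} {y} = subst (λ ws → eval ws x ≡ y) (sym (interval≡ascending i j))

  cyc-below : ∀ {x} → x < i → cyc i j x ≡ x
  cyc-below x<i = eval-interval (ascending-below len i x<i)

  cyc-inside : ∀ {x} → i ≤ x → x ≤ j → cyc i j x ≡ suc x
  cyc-inside {x} i≤x x≤j =
    eval-interval (ascending-inside len i i≤x (subst (x <_) (sym (interval-end (≤-trans i≤x x≤j))) (s≤s x≤j)))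

  cyc-top : i ≤ j → cyc i j (suc j) ≡ i
  cyc-top i≤j = eval-interval (subst (λ x → eval (ascending i len) x ≡ i) (interval-end i≤j) (ascending-end len i))

  cyc-above : ∀ {x} → i ≤ j → suc j < x → cyc i j x ≡ x
  cyc-above {x} i≤j j+1<x = eval-interval (ascending-above len i (subst (_< x) (sym (interval-end i≤j)) j+1<x))

  cyc⁻¹-cyc : ∀ x → cyc⁻¹ i j (cyc i j x) ≡ x
  cyc⁻¹-cyc = eval-reverse-inverseˡ (interval i j)

  cyc⁻¹-below : ∀ {x} → x < i → cyc⁻¹ i j x ≡ x
  cyc⁻¹-below {x} x<i = trans (cong (cyc⁻¹ i j) (sym (cyc-below x<i))) (cyc⁻¹-cyc x)

  cyc⁻¹-inside : ∀ {x} → i ≤ x → x ≤ j → cyc⁻¹ i j (suc x) ≡ x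
  cyc⁻¹-inside {x} i≤x x≤j = trans (cong (cyc⁻¹ i j) (sym (cyc-inside i≤x x≤j))) (cyc⁻¹-cyc x)

  cyc⁻¹-bottom : i ≤ j → cyc⁻¹ i j i ≡ suc j
  cyc⁻¹-bottom i≤j = trans (cong (cyc⁻¹ i j) (sym (cyc-top i≤j))) (cyc⁻¹-cyc (suc j))

  cyc⁻¹-above : ∀ {x} → i ≤ j → suc j < x → cyc⁻¹ i j x ≡ x
  cyc⁻¹-above {x} i≤j j+1<x = trans (cong (cyc⁻¹ i j) (sym (cyc-above i≤j j+1<x))) (cyc⁻¹-cyc x)

  data CycView : ℕ → Set where
    below  : ∀ {x} → x < i → CycView x
    inside : ∀ {x} → i ≤ x → x ≤ j → CycView x
    top    : CycView (suc j)
    above  : ∀ {x} → suc j < x → CycView x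

  cycView : ∀ x → CycView x
  cycView x with x <? i
  ... | yes x<i = below x<i
  ... | no x≮i with x ≤? j
  ...   | yes x≤j = inside (≮⇒≥ x≮i) x≤j
  ...   | no x≰j with m≤n⇒m<n∨m≡n (≰⇒> x≰j)
  ...     | inj₁ j+1<x = above j+1<x
  ...     | inj₂ refl = top

  data Cyc⁻¹View : ℕ → Set where
    below  : ∀ {x} → x < i → Cyc⁻¹View x
    bottom : Cyc⁻¹View i
    inside : ∀ {x} → i ≤ x → x ≤ j → Cyc⁻¹View (suc x)
    above  : ∀ {x} → suc j < x → Cyc⁻¹View x

  cyc⁻¹View : ∀ x → Cyc⁻¹View x
  cyc⁻¹View x with <-cmp x i
  ... | tri< x<i _ _ = below x<i
  ... | tri≈ _ refl _ = bottom
  cyc⁻¹View (suc x) | tri> _ _ i<x+1 with x ≤? j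
  ... | yes x≤j = inside (≤-pred i<x+1) x≤j
  ... | no x≰j = above (s≤s (≰⇒> x≰j))

  cyc-monotone : ∀ {x y} → x < y → y ≤ j → cyc i j x < cyc i j y
  cyc-monotone {x} {y} x<y y≤j with y <? i
  ... | yes y<i rewrite cyc-below (<-trans x<y y<i) | cyc-below y<i = x<y
  ... | no y≮i with x <? i
  ...   | yes x<i rewrite cyc-below x<i | cyc-inside (≮⇒≥ y≮i) y≤j = m<n⇒m<1+n x<y
  ...   | no x≮i rewrite cyc-inside (≮⇒≥ x≮i) (≤-trans (<⇒≤ x<y) y≤j) | cyc-inside (≮⇒≥ y≮i) y≤j = s≤s x<y

  cyc-bounded : ∀ {B x} → i ≤ j → j < B → x ≤ B → cyc i j x ≤ B
  cyc-bounded {B} {x} i≤j j<B x≤B with cycView x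
  ... | below x<i rewrite cyc-below x<i = x≤B
  ... | inside i≤x x≤j rewrite cyc-inside i≤x x≤j = ≤-trans (s≤s x≤j) j<B
  ... | top rewrite cyc-top i≤j = ≤-trans i≤j (<⇒≤ j<B)
  ... | above j+1<x rewrite cyc-above i≤j j+1<x = x≤B

  cyc-descent⇔ : ∀ {s} → i ≤ j → cyc i j (suc s) < cyc i j s ⇔ s ≡ j
  cyc-descent⇔ {s} i≤j = mk⇔ to λ { refl → subst₂ _<_ (sym (cyc-top i≤j)) (sym (cyc-inside i≤j ≤-refl)) (s≤s i≤j) }
    where
    to : cyc i j (suc s) < cyc i j s → s ≡ j
    to descent with <-cmp s j
    ... | tri< s<j _ _ = ⊥-elim (<-asym descent (cyc-monotone (n<1+n s) s<j))
    ... | tri≈ _ s≡j _ = s≡j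
    ... | tri> _ _ j<s = ⊥-elim (<-asym descent (subst (cyc i j s <_) (sym (cyc-above i≤j (s≤s j<s)))
                                                  (s≤s (cyc-bounded i≤j j<s ≤-refl))))

  cyc⁻¹-bounded : ∀ {B x} → i ≤ j → B ≤ i → B ≤ x → B ≤ cyc⁻¹ i j x
  cyc⁻¹-bounded {B} {x} i≤j B≤i B≤x with cyc⁻¹View x
  ... | below x<i rewrite cyc⁻¹-below x<i = B≤x
  ... | bottom rewrite cyc⁻¹-bottom i≤j = ≤-trans B≤i (m≤n⇒m≤1+n i≤j)
  ... | inside {y} i≤y y≤j rewrite cyc⁻¹-inside i≤y y≤j = ≤-trans B≤i i≤y
  ... | above j+1<x rewrite cyc⁻¹-above i≤j j+1<x = B≤x

  cyc⁻¹-≥ : ∀ {x} → i ≤ j → x ≤ i → x ≤ cyc⁻¹ i j x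
  cyc⁻¹-≥ {x} i≤j x≤i with m≤n⇒m<n∨m≡n x≤i
  ... | inj₁ x<i = ≤-reflexive (sym (cyc⁻¹-below x<i))
  ... | inj₂ refl = subst (x ≤_) (sym (cyc⁻¹-bottom i≤j)) (m≤n⇒m≤1+n i≤j)

  cyc⁻¹-monotone : ∀ {x y} → i ≤ j → i < x → x < y → cyc⁻¹ i j x < cyc⁻¹ i j y
  cyc⁻¹-monotone {x} {y} i≤j i<x x<y with cyc⁻¹View x | cyc⁻¹View y
  ... | below x<i | _ = ⊥-elim (<-asym x<i i<x)
  ... | bottom | _ = ⊥-elim (<-irrefl refl i<x)
  ... | above j+1<x | _ rewrite cyc⁻¹-above i≤j j+1<x | cyc⁻¹-above i≤j (<-trans j+1<x x<y) = x<y
  ... | inside _ _ | below y<i = ⊥-elim (<-asym y<i (<-trans i<x x<y))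
  ... | inside _ _ | bottom = ⊥-elim (<-asym i<x x<y)
  ... | inside i≤x′ x′≤j | inside i≤y′ y′≤j
      rewrite cyc⁻¹-inside i≤x′ x′≤j | cyc⁻¹-inside i≤y′ y′≤j = ≤-pred x<y
  ... | inside i≤x′ x′≤j | above j+1<y
      rewrite cyc⁻¹-inside i≤x′ x′≤j | cyc⁻¹-above i≤j j+1<y = <-trans (n<1+n _) x<y

  cyc⁻¹-descent⇔ : ∀ {s} → i ≤ j → cyc⁻¹ i j (suc s) < cyc⁻¹ i j s ⇔ s ≡ i
  cyc⁻¹-descent⇔ {s} i≤j =
    mk⇔ to λ { refl → subst₂ _<_ (sym (cyc⁻¹-inside ≤-refl i≤j)) (sym (cyc⁻¹-bottom i≤j)) (s≤s i≤j) }
    where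
    to : cyc⁻¹ i j (suc s) < cyc⁻¹ i j s → s ≡ i
    to descent with <-cmp s i
    ... | tri< s<i _ _ = ⊥-elim (<⇒≱ (subst (cyc⁻¹ i j (suc s) <_) (cyc⁻¹-below s<i) descent)
                                     (≤-trans (n≤1+n s) (cyc⁻¹-≥ i≤j s<i)))
    ... | tri≈ _ s≡i _ = s≡i
    ... | tri> _ _ i<s = ⊥-elim (<-asym descent (cyc⁻¹-monotone i≤j i<s (n<1+n s)))

reflects-< : ∀ (h : ℕ → ℕ) {x y} → (x < y → h x < h y) → h y < h x → y < x
reflects-< h {x} {y} mono hy<hx with <-cmp y x
... | tri< y<x _ _ = y<x
... | tri≈ _ refl _ = ⊥-elim (<-irrefl refl hy<hx)
... | tri> _ _ x<y = ⊥-elim (<-asym hy<hx (mono x<y))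

-- v stands for the product of the factors after [i,j]; it only moves points ≤ b.
cyc∘-descent⇔ : ∀ {i j b s} (v : Perm) → i ≤ j → b ≤ j →
  (∀ {x} → b < x → v x ≡ x) → (∀ {x} → x ≤ b → v x ≤ b) → v b < i →
  cyc i j (v (suc s)) < cyc i j (v s) ⇔ ((s ≡ j × b < j) ⊎ (s < j × v (suc s) < v s))
cyc∘-descent⇔ {i} {j} {b} {s} v i≤j b≤j v-fixes v-bounded vb<i = mk⇔ to from
  where
  v≤j : ∀ {x} → x ≤ j → v x ≤ j
  v≤j {x} x≤j with x ≤? b
  ... | yes x≤b = ≤-trans (v-bounded x≤b) b≤j
  ... | no x≰b = subst (_≤ j) (sym (v-fixes (≰⇒> x≰b))) x≤j

  to : cyc i j (v (suc s)) < cyc i j (v s) → (s ≡ j × b < j) ⊎ (s < j × v (suc s) < v s)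
  to descent with <-cmp s j
  ... | tri< s<j _ _ = inj₂ (s<j , reflects-< (cyc i j) (λ vs<vs+1 → cyc-monotone {i} {j} vs<vs+1 (v≤j s<j)) descent)
  ... | tri> _ _ j<s = ⊥-elim (<-irrefl (sym (Equivalence.to (cyc-descent⇔ i≤j)
          (subst₂ _<_ (cong (cyc i j) (v-fixes (m<n⇒m<1+n b<s))) (cong (cyc i j) (v-fixes b<s)) descent))) j<s)
    where
    b<s : b < s
    b<s = ≤-<-trans b≤j j<s
  ... | tri≈ _ refl _ with m≤n⇒m<n∨m≡n b≤j
  ...   | inj₁ b<j = inj₁ (refl , b<j)
  ...   | inj₂ refl = ⊥-elim (<-asym descent (subst₂ _<_
          (sym (cyc-below vb<i))
          (sym (trans (cong (cyc i j) (v-fixes (n<1+n b))) (cyc-top i≤j)))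
          vb<i))

  from : (s ≡ j × b < j) ⊎ (s < j × v (suc s) < v s) → cyc i j (v (suc s)) < cyc i j (v s)
  from (inj₁ (refl , b<j)) = subst₂ _<_
    (sym (trans (cong (cyc i j) (v-fixes (m<n⇒m<1+n b<j))) (cyc-top i≤j)))
    (sym (trans (cong (cyc i j) (v-fixes b<j)) (cyc-inside i≤j ≤-refl)))
    (s≤s i≤j)
  from (inj₂ (s<j , v-descent)) = cyc-monotone {i} {j} v-descent (v≤j (<⇒≤ s<j))

-- u stands for the inverse of the factors before [i,j]; it only moves points ≥ c.
cyc⁻¹∘-descent⇔ : ∀ {i j c s} (u : Perm) → i ≤ j → i < c →
  (∀ {x} → x < c → u x ≡ x) → (∀ {x} → c ≤ x → c ≤ u x) → suc j < u c →
  cyc⁻¹ i j (u (suc s)) < cyc⁻¹ i j (u s) ⇔ ((s ≡ i × suc i < c) ⊎ (i < s × u (suc s) < u s))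
cyc⁻¹∘-descent⇔ {i} {j} {c} {s} u i≤j i<c u-fixes u-bounded j+1<uc = mk⇔ to from
  where
  i<u : ∀ {x} → i < x → i < u x
  i<u {x} i<x with x <? c
  ... | yes x<c = subst (i <_) (sym (u-fixes x<c)) i<x
  ... | no x≮c = <-≤-trans i<c (u-bounded (≮⇒≥ x≮c))

  u-at-i : cyc⁻¹ i j (u i) ≡ suc j
  u-at-i = trans (cong (cyc⁻¹ i j) (u-fixes i<c)) (cyc⁻¹-bottom i≤j)

  to : cyc⁻¹ i j (u (suc s)) < cyc⁻¹ i j (u s) → (s ≡ i × suc i < c) ⊎ (i < s × u (suc s) < u s)
  to descent with <-cmp s i
  ... | tri< s<i _ _ = ⊥-elim (<-irrefl (Equivalence.to (cyc⁻¹-descent⇔ i≤j)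
          (subst₂ _<_ (cong (cyc⁻¹ i j) (u-fixes (≤-<-trans s<i i<c))) (cong (cyc⁻¹ i j) (u-fixes (<-trans s<i i<c)))
                      descent)) s<i)
  ... | tri> _ _ i<s = inj₂ (i<s , reflects-< (cyc⁻¹ i j) (cyc⁻¹-monotone i≤j (i<u i<s)) descent)
  ... | tri≈ _ refl _ with m≤n⇒m<n∨m≡n i<c
  ...   | inj₁ i+1<c = inj₁ (refl , i+1<c)
  ...   | inj₂ refl = ⊥-elim (<-asym descent (subst₂ _<_ (sym u-at-i) (sym (cyc⁻¹-above i≤j j+1<uc)) j+1<uc))

  from : (s ≡ i × suc i < c) ⊎ (i < s × u (suc s) < u s) → cyc⁻¹ i j (u (suc s)) < cyc⁻¹ i j (u s)
  from (inj₁ (refl , i+1<c)) = subst₂ _<_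
    (sym (trans (cong (cyc⁻¹ i j) (u-fixes i+1<c)) (cyc⁻¹-inside ≤-refl i≤j)))
    (sym u-at-i)
    (s≤s i≤j)
  from (inj₂ (i<s , u-descent)) = cyc⁻¹-monotone i≤j (i<u (m<n⇒m<1+n i<s)) u-descent

blocks : ℕ → (ℕ → ℕ) → (ℕ → ℕ) → Word
blocks zero i j = []
blocks (suc p) i j = interval (i 1) (j 1) ++ blocks p (i ∘ suc) (j ∘ suc)

prod : ℕ → (ℕ → ℕ) → (ℕ → ℕ) → Perm
prod p i j = eval (blocks p i j)

prod⁻¹ : ℕ → (ℕ → ℕ) → (ℕ → ℕ) → Perm
prod⁻¹ p i j = eval (reverse (blocks p i j))

canonWord≡blocks : ∀ p i j → canonWord p i j ≡ blocks p i j
canonWord≡blocks p i j = trans (cong (concatMap (λ t → interval (i t) (j t))) (map-applyUpTo id suc p)) (shifted p id)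
  where
  shifted : ∀ p h → concatMap (λ t → interval (i t) (j t)) (applyUpTo (h ∘ suc) p) ≡ blocks p (i ∘ h) (j ∘ h)
  shifted zero h = refl
  shifted (suc p) h = cong (interval (i (h 1)) (j (h 1)) ++_) (shifted p (h ∘ suc))

blocks-snoc : ∀ p i j → blocks (suc p) i j ≡ blocks p i j ++ interval (i (suc p)) (j (suc p))
blocks-snoc zero i j = ++-identityʳ _
blocks-snoc (suc p) i j = trans (cong (interval (i 1) (j 1) ++_) (blocks-snoc p (i ∘ suc) (j ∘ suc)))
  (sym (++-assoc (interval (i 1) (j 1)) (blocks p (i ∘ suc) (j ∘ suc)) _))

prod-suc : ∀ p i j x → prod (suc p) i j x ≡ cyc (i 1) (j 1) (prod p (i ∘ suc) (j ∘ suc) x)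
prod-suc p i j = eval-++ (interval (i 1) (j 1)) (blocks p (i ∘ suc) (j ∘ suc))

prod⁻¹-suc : ∀ p i j x → prod⁻¹ (suc p) i j x ≡ cyc⁻¹ (i (suc p)) (j (suc p)) (prod⁻¹ p i j x)
prod⁻¹-suc p i j x = begin
  eval (reverse (blocks (suc p) i j)) x               ≡⟨ cong (λ ws → eval (reverse ws) x) (blocks-snoc p i j) ⟩
  eval (reverse (blocks p i j ++ last)) x             ≡⟨ cong (λ ws → eval ws x) (reverse-++ (blocks p i j) last) ⟩
  eval (reverse last ++ reverse (blocks p i j)) x     ≡⟨ eval-++ (reverse last) (reverse (blocks p i j)) x ⟩
  cyc⁻¹ (i (suc p)) (j (suc p)) (prod⁻¹ p i j x)      ∎
  where
  open ≡-Reasoning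
  last : Word
  last = interval (i (suc p)) (j (suc p))

Within : ℕ → (ℕ → Set) → Set
Within p P = ∀ t → 1 ≤ t → t ≤ p → P t

within-tail : ∀ {p P} → Within (suc p) P → Within p (P ∘ suc)
within-tail P t _ t≤p = P (suc t) (s≤s z≤n) (s≤s t≤p)

within-first : ∀ {p P} → Within (suc p) P → P 1
within-first P = P 1 ≤-refl (s≤s z≤n)

within-last : ∀ {p P} → Within (suc p) P → P (suc p)
within-last {p} P = P (suc p) (s≤s z≤n) ≤-refl

within-init : ∀ {p P} → Within (suc p) P → Within p P
within-init P t 1≤t t≤p = P t 1≤t (m≤n⇒m≤1+n t≤p)

Decreasing : ℕ → (ℕ → ℕ) → Set
Decreasing p f = ∀ t → 1 ≤ t → t < p → f (suc t) < f t

decreasing-tail : ∀ {p f} → Decreasing (suc p) f → Decreasing p (f ∘ suc)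
decreasing-tail dec t _ t<p = dec (suc t) (s≤s z≤n) (s≤s t<p)

decreasing-init : ∀ {p f} → Decreasing (suc p) f → Decreasing p f
decreasing-init dec t 1≤t t<p = dec t 1≤t (m<n⇒m<1+n t<p)

decreasing-< : ∀ {p f a b} → Decreasing p f → 1 ≤ a → a < b → b ≤ p → f b < f a
decreasing-< {b = suc b} dec 1≤a a<b+1 b+1≤p with m≤n⇒m<n∨m≡n (≤-pred a<b+1)
... | inj₂ refl = dec b 1≤a b+1≤p
... | inj₁ a<b = <-trans (dec b (≤-trans 1≤a (<⇒≤ a<b)) b+1≤p) (decreasing-< dec 1≤a a<b (<⇒≤ b+1≤p))

decreasing-≤ : ∀ {p f a b} → Decreasing p f → 1 ≤ a → a ≤ b → b ≤ p → f b ≤ f a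
decreasing-≤ dec 1≤a a≤b b≤p with m≤n⇒m<n∨m≡n a≤b
... | inj₁ a<b = <⇒≤ (decreasing-< dec 1≤a a<b b≤p)
... | inj₂ refl = ≤-refl

record Canonical (p : ℕ) (i j : ℕ → ℕ) : Set where
  field
    nonempty     : Within p (λ t → i t ≤ j t)
    i-decreasing : Decreasing p i
    j-decreasing : Decreasing p j

open Canonical

canonical-tail : ∀ {p i j} → Canonical (suc p) i j → Canonical p (i ∘ suc) (j ∘ suc)
canonical-tail C = record
  { nonempty = within-tail (nonempty C)
  ; i-decreasing = decreasing-tail (i-decreasing C)
  ; j-decreasing = decreasing-tail (j-decreasing C) }

canonical-init : ∀ {p i j} → Canonical (suc p) i j → Canonical p i j
canonical-init C = record
  { nonempty = within-init (nonempty C)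
  ; i-decreasing = decreasing-init (i-decreasing C)
  ; j-decreasing = decreasing-init (j-decreasing C) }

prod-fixes-above : ∀ p {i j B x} → Within p (λ t → i t ≤ j t) → Within p (λ t → j t < B) → B < x →
                   prod p i j x ≡ x
prod-fixes-above zero _ _ _ = refl
prod-fixes-above (suc p) {i} {j} {x = x} nonempty below-B B<x = trans (prod-suc p i j x)
  (trans (cong (cyc (i 1) (j 1)) (prod-fixes-above p (within-tail nonempty) (within-tail below-B) B<x))
         (cyc-above (within-first nonempty) (≤-<-trans (within-first below-B) B<x)))

prod-bounded : ∀ p {i j B x} → Within p (λ t → i t ≤ j t) → Within p (λ t → j t < B) → x ≤ B →
               prod p i j x ≤ B
prod-bounded zero _ _ x≤B = x≤B
prod-bounded (suc p) {i} {j} {x = x} nonempty below-B x≤B = subst (_≤ _) (sym (prod-suc p i j x))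
  (cyc-bounded (within-first nonempty) (within-first below-B)
    (prod-bounded p (within-tail nonempty) (within-tail below-B) x≤B))

prod⁻¹-fixes-below : ∀ p {i j B x} → Within p (λ t → i t ≤ j t) → Within p (λ t → B ≤ i t) → x < B →
                     prod⁻¹ p i j x ≡ x
prod⁻¹-fixes-below zero _ _ _ = refl
prod⁻¹-fixes-below (suc p) {i} {j} {x = x} nonempty above-B x<B = trans (prod⁻¹-suc p i j x)
  (trans (cong (cyc⁻¹ (i (suc p)) (j (suc p))) (prod⁻¹-fixes-below p (within-init nonempty) (within-init above-B) x<B))
         (cyc⁻¹-below (<-≤-trans x<B (within-last above-B))))

prod⁻¹-bounded : ∀ p {i j B x} → Within p (λ t → i t ≤ j t) → Within p (λ t → B ≤ i t) → B ≤ x →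
                 B ≤ prod⁻¹ p i j x
prod⁻¹-bounded zero _ _ B≤x = B≤x
prod⁻¹-bounded (suc p) {i} {j} {x = x} nonempty above-B B≤x = subst (_ ≤_) (sym (prod⁻¹-suc p i j x))
  (cyc⁻¹-bounded (within-last nonempty) (within-last above-B)
    (prod⁻¹-bounded p (within-init nonempty) (within-init above-B) B≤x))

prod-top : ∀ p {i j} → Canonical (suc p) i j → prod (suc p) i j (suc (j 1)) ≡ i 1
prod-top p {i} {j} C = trans (prod-suc p i j _)
  (trans (cong (cyc (i 1) (j 1)) (prod-fixes-above p (nonempty (canonical-tail C)) j<j1 (n<1+n (j 1))))
         (cyc-top (within-first (nonempty C))))
  where
  j<j1 : Within p (λ t → j (suc t) < j 1)
  j<j1 t 1≤t t≤p = decreasing-< (j-decreasing C) ≤-refl (s≤s 1≤t) (s≤s t≤p)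

prod⁻¹-bottom : ∀ p {i j} → Canonical (suc p) i j → prod⁻¹ (suc p) i j (i (suc p)) ≡ suc (j (suc p))
prod⁻¹-bottom p {i} {j} C = trans (prod⁻¹-suc p i j _)
  (trans (cong (cyc⁻¹ (i (suc p)) (j (suc p))) (prod⁻¹-fixes-below p (nonempty (canonical-init C)) i>last (n<1+n _)))
         (cyc⁻¹-bottom (within-last (nonempty C))))
  where
  i>last : Within p (λ t → suc (i (suc p)) ≤ i t)
  i>last t 1≤t t≤p = decreasing-< (i-decreasing C) 1≤t (s≤s t≤p) ≤-refl

CanonicalRightDescent : ℕ → (ℕ → ℕ) → ℕ → Set
CanonicalRightDescent p j s = s ≡ j p ⊎ ∃[ k ] (1 ≤ k × k < p × suc (j (suc k)) < j k × s ≡ j k)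

CanonicalLeftDescent : ℕ → (ℕ → ℕ) → ℕ → Set
CanonicalLeftDescent p i s = s ≡ i 1 ⊎ ∃[ k ] (2 ≤ k × k ≤ p × suc (i k) < i (pred k) × s ≡ i k)

prod-descent-step : ∀ q {i j s} → Canonical (2 + q) i j →
  prod (2 + q) i j (suc s) < prod (2 + q) i j s ⇔
  ((s ≡ j 1 × suc (j 2) < j 1) ⊎ (s < j 1 × prod (suc q) (i ∘ suc) (j ∘ suc) (suc s) < prod (suc q) (i ∘ suc) (j ∘ suc) s))
prod-descent-step q {i} {j} {s} C rewrite prod-suc (suc q) i j (suc s) | prod-suc (suc q) i j s =
  cyc∘-descent⇔ {s = s} (prod (suc q) (i ∘ suc) (j ∘ suc))
    (within-first (nonempty C)) (j-decreasing C 1 ≤-refl (s≤s (s≤s z≤n)))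
    (prod-fixes-above (suc q) (nonempty T) tail-below) (prod-bounded (suc q) (nonempty T) tail-below)
    (subst (_< i 1) (sym (prod-top q T)) (i-decreasing C 1 ≤-refl (s≤s (s≤s z≤n))))
  where
  T = canonical-tail C
  tail-below : Within (suc q) (λ t → j (suc t) < suc (j 2))
  tail-below t 1≤t t≤q+1 = s≤s (decreasing-≤ (j-decreasing T) ≤-refl 1≤t t≤q+1)

prod⁻¹-descent-step : ∀ q {i j s} → Canonical (2 + q) i j →
  prod⁻¹ (2 + q) i j (suc s) < prod⁻¹ (2 + q) i j s ⇔
  ((s ≡ i (2 + q) × suc (i (2 + q)) < i (suc q)) ⊎ (i (2 + q) < s × prod⁻¹ (suc q) i j (suc s) < prod⁻¹ (suc q) i j s))
prod⁻¹-descent-step q {i} {j} {s} C rewrite prod⁻¹-suc (suc q) i j (suc s) | prod⁻¹-suc (suc q) i j s =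
  cyc⁻¹∘-descent⇔ {s = s} (prod⁻¹ (suc q) i j)
    (within-last (nonempty C)) (i-decreasing C (suc q) (s≤s z≤n) ≤-refl)
    (prod⁻¹-fixes-below (suc q) (nonempty I) init-above) (prod⁻¹-bounded (suc q) (nonempty I) init-above)
    (subst (suc (j (2 + q)) <_) (sym (prod⁻¹-bottom q I)) (s≤s (j-decreasing C (suc q) (s≤s z≤n) ≤-refl)))
  where
  I = canonical-init C
  init-above : Within (suc q) (λ t → i (suc q) ≤ i t)
  init-above t 1≤t t≤q+1 = decreasing-≤ (i-decreasing I) 1≤t t≤q+1 ≤-refl

prod-descent⇔ : ∀ q {i j s} → Canonical (suc q) i j →
  prod (suc q) i j (suc s) < prod (suc q) i j s ⇔ CanonicalRightDescent (suc q) j s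
prod-descent⇔ zero {i} {j} {s} C rewrite prod-suc 0 i j (suc s) | prod-suc 0 i j s =
  ⇔-trans (cyc-descent⇔ (within-first (nonempty C)))
          (mk⇔ inj₁ λ { (inj₁ s≡j1) → s≡j1 ; (inj₂ (_ , 1≤k , k<1 , _)) → ⊥-elim (<⇒≱ k<1 1≤k) })
prod-descent⇔ (suc q) {i} {j} {s} C = ⇔-trans (prod-descent-step q C) (mk⇔ to from)
  where
  IH = prod-descent⇔ q (canonical-tail C)
  v = prod (suc q) (i ∘ suc) (j ∘ suc)

  to : (s ≡ j 1 × suc (j 2) < j 1) ⊎ (s < j 1 × v (suc s) < v s) → CanonicalRightDescent (2 + q) j s
  to (inj₁ (s≡j1 , gap)) = inj₂ (1 , ≤-refl , s≤s (s≤s z≤n) , gap , s≡j1)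
  to (inj₂ (_ , tail-descent)) with Equivalence.to IH tail-descent
  ... | inj₁ s≡last = inj₁ s≡last
  ... | inj₂ (k , _ , k<q+1 , gap , s≡jk) = inj₂ (suc k , s≤s z≤n , s≤s k<q+1 , gap , s≡jk)

  j<j1 : ∀ {k} → 1 ≤ k → k ≤ suc q → j (suc k) < j 1
  j<j1 1≤k k≤q+1 = decreasing-< (j-decreasing C) ≤-refl (s≤s 1≤k) (s≤s k≤q+1)

  from : CanonicalRightDescent (2 + q) j s → (s ≡ j 1 × suc (j 2) < j 1) ⊎ (s < j 1 × v (suc s) < v s)
  from (inj₁ refl) = inj₂ (j<j1 (s≤s z≤n) ≤-refl , Equivalence.from IH (inj₁ refl))
  from (inj₂ (1 , _ , _ , gap , s≡j1)) = inj₁ (s≡j1 , gap)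
  from (inj₂ (suc (suc k) , _ , k+2<q+2 , gap , refl)) =
    inj₂ (j<j1 (s≤s z≤n) (≤-pred (<⇒≤ k+2<q+2)) ,
          Equivalence.from IH (inj₂ (suc k , s≤s z≤n , ≤-pred k+2<q+2 , gap , refl)))

prod⁻¹-descent⇔ : ∀ q {i j s} → Canonical (suc q) i j →
  prod⁻¹ (suc q) i j (suc s) < prod⁻¹ (suc q) i j s ⇔ CanonicalLeftDescent (suc q) i s
prod⁻¹-descent⇔ zero {i} {j} {s} C rewrite prod⁻¹-suc 0 i j (suc s) | prod⁻¹-suc 0 i j s =
  ⇔-trans (cyc⁻¹-descent⇔ (within-first (nonempty C)))
          (mk⇔ inj₁ λ { (inj₁ s≡i1) → s≡i1 ; (inj₂ (_ , 2≤k , k≤1 , _)) → ⊥-elim (<⇒≱ 2≤k k≤1) })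
prod⁻¹-descent⇔ (suc q) {i} {j} {s} C = ⇔-trans (prod⁻¹-descent-step q C) (mk⇔ to from)
  where
  IH = prod⁻¹-descent⇔ q (canonical-init C)
  u = prod⁻¹ (suc q) i j

  to : (s ≡ i (2 + q) × suc (i (2 + q)) < i (suc q)) ⊎ (i (2 + q) < s × u (suc s) < u s) →
       CanonicalLeftDescent (2 + q) i s
  to (inj₁ (s≡last , gap)) = inj₂ (2 + q , s≤s (s≤s z≤n) , ≤-refl , gap , s≡last)
  to (inj₂ (_ , init-descent)) with Equivalence.to IH init-descent
  ... | inj₁ s≡i1 = inj₁ s≡i1
  ... | inj₂ (k , 2≤k , k≤q+1 , gap , s≡ik) = inj₂ (k , 2≤k , m≤n⇒m≤1+n k≤q+1 , gap , s≡ik)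

  last<i : ∀ {k} → 1 ≤ k → k < 2 + q → i (2 + q) < i k
  last<i 1≤k k<q+2 = decreasing-< (i-decreasing C) 1≤k k<q+2 ≤-refl

  from : CanonicalLeftDescent (2 + q) i s →
         (s ≡ i (2 + q) × suc (i (2 + q)) < i (suc q)) ⊎ (i (2 + q) < s × u (suc s) < u s)
  from (inj₁ refl) = inj₂ (last<i ≤-refl (s≤s (s≤s z≤n)) , Equivalence.from IH (inj₁ refl))
  from (inj₂ (k , 2≤k , k≤q+2 , gap , s≡ik)) with m≤n⇒m<n∨m≡n k≤q+2
  ... | inj₂ refl = inj₁ (s≡ik , gap)
  ... | inj₁ k<q+2 = inj₂ (subst (i (2 + q) <_) (sym s≡ik) (last<i (≤-trans (s≤s z≤n) 2≤k) k<q+2) ,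
                          Equivalence.from IH (inj₂ (k , 2≤k , ≤-pred k<q+2 , gap , s≡ik)))

ValidWord-ascending : ∀ {n} m i → 1 ≤ i → i + m ≤ suc n → ValidWord n (ascending i m)
ValidWord-ascending zero i _ _ = []
ValidWord-ascending {n} (suc m) i 1≤i i+m+1≤n+1 =
  (1≤i , ≤-pred (≤-trans (s≤s (m≤m+n i m)) i+1+m≤n+1)) ∷ ValidWord-ascending m (suc i) (m≤n⇒m≤1+n 1≤i) i+1+m≤n+1
  where
  i+1+m≤n+1 : suc i + m ≤ suc n
  i+1+m≤n+1 = subst (_≤ suc n) (+-suc i m) i+m+1≤n+1

ValidWord-interval : ∀ {n i j} → 1 ≤ i → i ≤ j → j ≤ n → ValidWord n (interval i j)
ValidWord-interval {n} {i} {j} 1≤i i≤j j≤n = subst (ValidWord n) (sym (interval≡ascending i j))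
  (ValidWord-ascending _ i 1≤i (subst (_≤ suc n) (sym (interval-end i≤j)) (s≤s j≤n)))

ValidWord-blocks : ∀ p {n i j} → Within p (λ t → i t ≤ j t) → Within p (λ t → 1 ≤ i t) → Within p (λ t → j t ≤ n) →
                   ValidWord n (blocks p i j)
ValidWord-blocks zero _ _ _ = []
ValidWord-blocks (suc p) nonempty positive bounded =
  ++⁺ (ValidWord-interval (within-first positive) (within-first nonempty) (within-first bounded))
      (ValidWord-blocks p (within-tail nonempty) (within-tail positive) (within-tail bounded))

leftDescent-eval⇔ : ∀ {n s} ws → ValidWord n ws → 1 ≤ s → s ≤ n →
  LeftDescent n s (eval ws) ⇔ eval (reverse ws) (suc s) < eval (reverse ws) s
leftDescent-eval⇔ {s = s} ws valid 1≤s s≤n =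
  subst₂ (λ x y → LeftDescent _ s (eval ws) ⇔ x < y) (inverse≈ (suc s)) (inverse≈ s) (leftDescent⇔ F 1≤s s≤n)
  where
  F = InSym-eval ws valid
  inverse≈ : ∀ x → inverse F x ≡ eval (reverse ws) x
  inverse≈ x = trans (cong (inverse F) (sym (eval-reverse-inverseʳ ws x))) (inverse-f F _)

mainTheorem14 : (n p : ℕ) (i j : ℕ → ℕ) →
    1 ≤ p →
    j 1 ≤ n → (∀ t → 1 ≤ t → t < p → j (suc t) < j t) → 1 ≤ j p →
    i 1 ≤ n → (∀ t → 1 ≤ t → t < p → i (suc t) < i t) → 1 ≤ i p →
    (∀ t → 1 ≤ t → t ≤ p → i t ≤ j t) →
    FullyCommutative n (canonElt p i j) →
    (∀ s → 1 ≤ s → s ≤ n →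
      (LeftDescent n s (canonElt p i j) ⇔
        (s ≡ i 1 ⊎ ∃[ k ] (2 ≤ k × k ≤ p × suc (i k) < i (pred k) × s ≡ i k)))) ×
    (∀ s → 1 ≤ s → s ≤ n →
      (RightDescent n s (canonElt p i j) ⇔
        (s ≡ j p ⊎ ∃[ k ] (1 ≤ k × k < p × suc (j (suc k)) < j k × s ≡ j k))))
mainTheorem14 _ zero _ _ ()
mainTheorem14 n (suc q) i j _ j1≤n j-dec _ _ i-dec 1≤ip nonempty _ = left , right
  where
  C : Canonical (suc q) i j
  C = record { nonempty = nonempty ; i-decreasing = i-dec ; j-decreasing = j-dec }

  ws≡blocks : canonWord (suc q) i j ≡ blocks (suc q) i j
  ws≡blocks = canonWord≡blocks (suc q) i j

  valid : ValidWord n (canonWord (suc q) i j)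
  valid = subst (ValidWord n) (sym ws≡blocks) (ValidWord-blocks (suc q) nonempty
    (λ t 1≤t t≤p → ≤-trans 1≤ip (decreasing-≤ i-dec 1≤t t≤p ≤-refl))
    (λ t 1≤t t≤p → ≤-trans (decreasing-≤ j-dec ≤-refl 1≤t t≤p) j1≤n))

  left : ∀ s → 1 ≤ s → s ≤ n → LeftDescent n s (canonElt (suc q) i j) ⇔ CanonicalLeftDescent (suc q) i s
  left s 1≤s s≤n = ⇔-trans (leftDescent-eval⇔ _ valid 1≤s s≤n)
    (subst (λ ws → eval (reverse ws) (suc s) < eval (reverse ws) s ⇔ CanonicalLeftDescent (suc q) i s)
           (sym ws≡blocks) (prod⁻¹-descent⇔ q C))

  right : ∀ s → 1 ≤ s → s ≤ n → RightDescent n s (canonElt (suc q) i j) ⇔ CanonicalRightDescent (suc q) j s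
  right s 1≤s s≤n = ⇔-trans (rightDescent⇔ (InSym-eval _ valid) 1≤s s≤n)
    (subst (λ ws → eval ws (suc s) < eval ws s ⇔ CanonicalRightDescent (suc q) j s)
           (sym ws≡blocks) (prod-descent⇔ q C))
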